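{- Let $\Gamma$ be a finite Abelian group of order $k$ and $j$ a positive integer. If $j>1$ and either $j$ is even or $\Gamma$ is of odd order or contains more than one involution, then a $\Gamma$-Kotzig array of size $j\times k$ exists.
   Context: For a finite Abelian group $\Gamma$ (written additively) of order $k$, a $\Gamma$-Kotzig array of size $j\times k$ is a $j\times k$ array with entries in $\Gamma$ such that each row contains every element of $\Gamma$ exactly once and all $k$ column sums are equal. An involution is an element $\iota\neq 0$ with $2\iota=0$. -}

module Defs where

open import Level using (Level)
open import Data.Nat using (ℕ; zero; suc)
open import Data.Fin using (Fin; zero; suc)
open import Data.Product using (Σ; _×_; ∃)
open import Relation.Nullary using (¬_)
open import Algebra.Bundles using (AbelianGroup)

module _ {c ℓ : Level} (G : AbelianGroup c ℓ) where
  open AbelianGroup G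

  IsBijectiveEnum : {k : ℕ} → (Fin k → Carrier) → Set (c Level.⊔ ℓ)
  IsBijectiveEnum {k} f =
    ((a b : Fin k) → f a ≈ f b → a ≡ b) × ((x : Carrier) → ∃ λ a → f a ≈ x)
    where open import Relation.Binary.PropositionalEquality using (_≡_)

  HasOrder : ℕ → Set (c Level.⊔ ℓ)
  HasOrder k = Σ (Fin k → Carrier) IsBijectiveEnum

  sumFin : (j : ℕ) → (Fin j → Carrier) → Carrier
  sumFin zero    f = ε
  sumFin (suc j) f = f zero ∙ sumFin j (λ i → f (suc i))

  IsKotzigArray : (j k : ℕ) → (Fin j → Fin k → Carrier) → Set (c Level.⊔ ℓ)
  IsKotzigArray j k A =
    ((r : Fin j) → IsBijectiveEnum (A r)) ×
    ((a b : Fin k) → sumFin j (λ r → A r a) ≈ sumFin j (λ r → A r b))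

  IsInvolution : Carrier → Set ℓ
  IsInvolution x = (¬ (x ≈ ε)) × (x ∙ x ≈ ε)

  MoreThanOneInvolution : Set (c Level.⊔ ℓ)
  MoreThanOneInvolution =
    Σ Carrier λ x → Σ Carrier λ y → IsInvolution x × IsInvolution y × ¬ (x ≈ y)

-- Stacking pairs of rows (e, −e) for an enumeration e of Γ changes no column sum, so even j is easy and
-- odd j reduces to j = 3. A 3 × k array exists as soon as the sum Σ of all elements of Γ vanishes: by
-- Hall's theorem the identity family is a difference a − b of two permutations, and the rows a, −b, −id
-- have zero column sums. Pairing x with −x shows that Σ is the sum of the self-inverse elements, which is
-- ε if Γ has no involution. For an involution u, pairing x with x ∙ u shows that |Γ| is even (so odd
-- order excludes involutions) and that Σ = h · u with 2h the number of self-inverse elements; given two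
-- involutions u ≠ v, also u ∙ v is one, and h · u = h · v = h · (u ∙ v) forces Σ = Σ ∙ Σ, i.e. Σ = ε.

module Submission where

open import Defs
open import Level using (Level; 0ℓ)
open import Data.Nat using (ℕ; zero; suc; _<_; _≤_; _+_; _*_; z≤n; s≤s)
open import Data.Nat.Divisibility using (_∣_; _∣?_; ∣-refl; m∣m*n; ∣m+n∣m⇒∣n)
open import Data.Nat.Properties as ℕ using (allUpTo?; anyUpTo?)
open import Data.Fin using (Fin; zero; suc; punchOut)
open import Data.Vec.Functional using ([]; _∷_)
open import Data.Fin.Properties as Fin
  using (any?; _≟_; _<?_; ¬Fin0; toℕ<n; toℕ-injective; punchOut-injective; injective⇒≤; <⇒notInjective)
open import Data.Fin.Permutation using (Permutation; permutation)
open import Data.Product using (Σ; ∃; _×_; _,_; proj₁; proj₂)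
open import Data.Sum using (_⊎_; inj₁; inj₂; [_,_]′; map₁; map₂)
open import Data.Empty using (⊥-elim)
open import Function using (_∘_)
open import Function.Definitions using (Injective)
open import Relation.Nullary using (¬_; Dec; yes; no; does; ¬?)
open import Relation.Nullary.Decidable using (dec-true; dec-false; does-⇔; from-no)
open import Relation.Binary using (tri<; tri≈; tri>)
open import Data.Bool using (Bool; true; false; if_then_else_; _∧_)
open import Relation.Unary using (Pred; Decidable)
open import Relation.Binary.PropositionalEquality as ≡ using (_≡_; _≢_; refl; cong; cong₂; subst)
open import Algebra.Bundles using (AbelianGroup; CommutativeMonoid)
open import Algebra.Structures using (IsAbelianGroup)
open import Algebra.Core using (Op₁; Op₂)
open import Function.Bundles using (mk⇔)
open import Algebra.Properties.CommutativeMonoid.Sum ℕ.+-0-commutativeMonoid as ℕΣ using ()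

injective-missing⇒≤ : ∀ {m n} {f : Fin m → Fin (suc n)} {y} →
  Injective _≡_ _≡_ f → (∀ i → f i ≢ y) → m ≤ n
injective-missing⇒≤ f-injective f≢y = injective⇒≤ punched-injective
  where
  punched-injective : Injective _≡_ _≡_ (λ i → punchOut (f≢y i ∘ ≡.sym))
  punched-injective eq = f-injective (punchOut-injective (f≢y _ ∘ ≡.sym) (f≢y _ ∘ ≡.sym) eq)

injective⇒surjective : ∀ {n} {f : Fin n → Fin n} → Injective _≡_ _≡_ f → ∀ y → ∃ λ x → f x ≡ y
injective⇒surjective {suc n} {f} f-injective y with any? (λ x → f x ≟ y)
... | yes hit = hit
... | no miss = ⊥-elim (ℕ.1+n≰n (injective-missing⇒≤ f-injective (λ x fx≡y → miss (x , fx≡y))))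

injective⇒permutation : ∀ {n} {f : Fin n → Fin n} → Injective _≡_ _≡_ f → Permutation n n
injective⇒permutation {f = f} f-injective =
  permutation f (proj₁ ∘ surjective) (proj₂ ∘ surjective) (λ x → f-injective (proj₂ (surjective (f x))))
  where
  surjective : ∀ y → ∃ λ x → f x ≡ y
  surjective = injective⇒surjective f-injective

∃-missing : ∀ {m n} {f : Fin m → Fin n} → m < n → Injective _≡_ _≡_ f → ∃ λ y → ∀ i → f i ≢ y
∃-missing {m} {n} {f} m<n f-injective with any? (λ y → ¬? (any? (λ i → f i ≟ y)))
... | yes (y , unhit) = y , λ i fi≡y → unhit (i , fi≡y)
... | no all-hit = ⊥-elim (ℕ.<⇒≱ m<n (injective⇒≤ preimage-injective))
  where
  preimage : ∀ y → ∃ λ i → f i ≡ y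
  preimage y with any? (λ i → f i ≟ y)
  ... | yes hit = hit
  ... | no unhit = ⊥-elim (all-hit (y , unhit))
  preimage-injective : Injective _≡_ _≡_ (proj₁ ∘ preimage)
  preimage-injective {y} {y'} eq =
    ≡.trans (≡.sym (proj₂ (preimage y))) (≡.trans (cong f eq) (proj₂ (preimage y')))

suc-injective⇒injective : ∀ {m n} {f : Fin (suc m) → Fin n} →
  (∀ i → f (suc i) ≢ f zero) → Injective _≡_ _≡_ (f ∘ suc) → Injective _≡_ _≡_ f
suc-injective⇒injective fresh inj {zero}  {zero}  _  = refl
suc-injective⇒injective fresh inj {zero}  {suc j} eq = ⊥-elim (fresh j (≡.sym eq))
suc-injective⇒injective fresh inj {suc i} {zero}  eq = ⊥-elim (fresh i eq)
suc-injective⇒injective fresh inj {suc i} {suc j} eq = cong suc (inj eq)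

least-counterexample : ∀ {p} {P : Pred ℕ p} → Decidable P → ∀ v → ¬ (∀ {t} → t < v → P t) →
  ∃ λ s → ¬ P s × (∀ {t} → t < s → P t)
least-counterexample P? zero    ¬all = ⊥-elim (¬all (λ ()))
least-counterexample P? (suc v) ¬all with allUpTo? P? v
... | yes P<v  = v , (λ Pv → ¬all (λ t<1+v → [ P<v , (λ { refl → Pv }) ]′ (ℕ.m<1+n⇒m<n∨m≡n t<1+v)))
                  , P<v
... | no ¬P<v = least-counterexample P? v ¬P<v

count : ∀ {n} → (Fin n → Bool) → ℕ
count b = ℕΣ.sum (λ x → if b x then 1 else 0)

module FinSums {c ℓ} (M : CommutativeMonoid c ℓ) where

  open CommutativeMonoid M renaming (refl to ≈-refl)
  open import Algebra.Properties.CommutativeMonoid.Sum M public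
  open import Algebra.Properties.CommutativeMonoid.Mult M public renaming (_×_ to _·_)
  open import Relation.Binary.Reasoning.Setoid setoid

  sum-∘-injective : ∀ {n} {π : Fin n → Fin n} → Injective _≡_ _≡_ π → ∀ f → sum (f ∘ π) ≈ sum f
  sum-∘-injective π-injective f = sym (sum-permute f (injective⇒permutation π-injective))

  sum-indicator : ∀ {n} (b : Fin n → Bool) u → sum (λ x → if b x then u else ε) ≈ count b · u
  sum-indicator {zero}  b u = ≈-refl
  sum-indicator {suc n} b u = begin
    (if b zero then u else ε) ∙ sum (λ x → if b (suc x) then u else ε)
      ≈⟨ ∙-cong (indicator (b zero)) (sum-indicator (b ∘ suc) u) ⟩
    (if b zero then 1 else 0) · u ∙ count (b ∘ suc) · u
      ≈⟨ ×-homo-+ u (if b zero then 1 else 0) (count (b ∘ suc)) ⟨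
    count b · u ∎
    where
    indicator : ∀ β → (if β then u else ε) ≈ (if β then 1 else 0) · u
    indicator true  = sym (×-homo-1 u)
    indicator false = ≈-refl

  module _ {n} (σ : Fin n → Fin n) (σ-involutive : ∀ x → σ (σ x) ≡ x) where

    sum-involution : ∀ f → sum f ≈
      sum (λ x → if does (x <? σ x) then f x ∙ f (σ x) else ε) ∙
      sum (λ x → if does (x ≟ σ x) then f x else ε)
    sum-involution f = begin
      sum f                                        ≈⟨ sum-cong-≋ trichotomy ⟩
      sum (λ x → below x ∙ (above x ∙ fixed x))    ≈⟨ ∑-distrib-+ below _ ⟩
      sum below ∙ sum (λ x → above x ∙ fixed x)    ≈⟨ ∙-congˡ (∑-distrib-+ above fixed) ⟩
      sum below ∙ (sum above ∙ sum fixed)          ≈⟨ ∙-congˡ (∙-congʳ above≈mirror) ⟩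
      sum below ∙ (sum mirror ∙ sum fixed)         ≈⟨ assoc _ _ _ ⟨
      (sum below ∙ sum mirror) ∙ sum fixed         ≈⟨ ∙-congʳ (∑-distrib-+ below mirror) ⟨
      sum (λ x → below x ∙ mirror x) ∙ sum fixed   ≈⟨ ∙-congʳ (sum-cong-≋ (λ x → pair (does (x <? σ x)))) ⟩
      sum (λ x → if does (x <? σ x) then f x ∙ f (σ x) else ε) ∙ sum fixed ∎
      where
      below above mirror fixed : Fin n → Carrier
      below  x = if does (x <? σ x) then f x else ε
      above  x = if does (σ x <? x) then f x else ε
      mirror x = if does (x <? σ x) then f (σ x) else ε
      fixed  x = if does (x ≟ σ x) then f x else ε

      trichotomy : ∀ x → f x ≈ below x ∙ (above x ∙ fixed x)
      trichotomy x with Fin.<-cmp x (σ x)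
      ... | tri< lt ¬eq ¬gt rewrite dec-true (x <? σ x) lt | dec-false (σ x <? x) ¬gt | dec-false (x ≟ σ x) ¬eq
        = sym (trans (∙-congˡ (identityˡ ε)) (identityʳ (f x)))
      ... | tri≈ ¬lt eq ¬gt rewrite dec-false (x <? σ x) ¬lt | dec-false (σ x <? x) ¬gt | dec-true (x ≟ σ x) eq
        = sym (trans (identityˡ _) (identityˡ (f x)))
      ... | tri> ¬lt ¬eq gt rewrite dec-false (x <? σ x) ¬lt | dec-true (σ x <? x) gt | dec-false (x ≟ σ x) ¬eq
        = sym (trans (identityˡ _) (identityʳ (f x)))

      above≈mirror : sum above ≈ sum mirror
      above≈mirror = begin
        sum above       ≈⟨ sum-∘-injective σ-injective above ⟨
        sum (above ∘ σ) ≡⟨ sum-cong-≗ mirrored ⟩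
        sum mirror      ∎
        where
        σ-injective : Injective _≡_ _≡_ σ
        σ-injective {x} {y} eq = ≡.trans (≡.sym (σ-involutive x)) (≡.trans (cong σ eq) (σ-involutive y))
        mirrored : ∀ x → above (σ x) ≡ mirror x
        mirrored x rewrite σ-involutive x = refl

      pair : ∀ {x} β → (if β then f x else ε) ∙ (if β then f (σ x) else ε) ≈
                       (if β then f x ∙ f (σ x) else ε)
      pair true  = ≈-refl
      pair false = identityˡ ε

    sum-fixedPointFree-involution : (∀ x → σ x ≢ x) → ∀ f →
      sum f ≈ sum (λ x → if does (x <? σ x) then f x ∙ f (σ x) else ε)
    sum-fixedPointFree-involution σx≢x f = begin
      sum f                                        ≈⟨ sum-involution f ⟩
      sum pairs ∙ sum (λ x → if does (x ≟ σ x) then f x else ε)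
                                                   ≡⟨ cong (sum pairs ∙_) (sum-cong-≗ no-fixed) ⟩
      sum pairs ∙ sum {n} (λ _ → ε)                ≈⟨ ∙-congˡ (sum-replicate-zero n) ⟩
      sum pairs ∙ ε                                ≈⟨ identityʳ _ ⟩
      sum pairs                                    ∎
      where
      pairs : Fin n → Carrier
      pairs x = if does (x <? σ x) then f x ∙ f (σ x) else ε
      no-fixed : ∀ x → (if does (x ≟ σ x) then f x else ε) ≡ ε
      no-fixed x rewrite dec-false (x ≟ σ x) (σx≢x x ∘ ≡.sym) = refl

count-true : ∀ n → count {n} (λ _ → true) ≡ n
count-true zero    = refl
count-true (suc n) = cong suc (count-true n)

count-invariant : ∀ {n} (σ : Fin n → Fin n) → (∀ x → σ (σ x) ≡ x) → (∀ x → σ x ≢ x) →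
  ∀ {b : Fin n → Bool} → (∀ x → b (σ x) ≡ b x) →
  count b ≡ 2 * count (λ x → does (x <? σ x) ∧ b x)
count-invariant {n} σ σ-involutive σ-fixedPointFree {b} b-invariant = begin
  count b
    ≡⟨ FinSums.sum-fixedPointFree-involution ℕ.+-0-commutativeMonoid σ σ-involutive σ-fixedPointFree ind ⟩
  ℕΣ.sum (λ x → if does (x <? σ x) then ind x + ind (σ x) else 0)
    ≡⟨ ℕΣ.sum-cong-≗ doubled ⟩
  ℕΣ.sum (λ x → half x + half x)
    ≡⟨ ℕΣ.∑-distrib-+ half half ⟩
  ℕΣ.sum half + ℕΣ.sum half
    ≡⟨ cong (ℕΣ.sum half +_) (ℕ.+-identityʳ _) ⟨
  2 * ℕΣ.sum half ∎
  where
  open ≡.≡-Reasoning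
  ind half : Fin n → ℕ
  ind x = if b x then 1 else 0
  half x = if does (x <? σ x) ∧ b x then 1 else 0
  doubled : ∀ x → (if does (x <? σ x) then ind x + ind (σ x) else 0) ≡ half x + half x
  doubled x rewrite b-invariant x with does (x <? σ x) | b x
  ... | true  | true  = refl
  ... | true  | false = refl
  ... | false | _     = refl

-- Kotzig arrays from a 3-row array

module _ {c ℓ} (G : AbelianGroup c ℓ) where

  open AbelianGroup G renaming (refl to ≈-refl)
  open import Algebra.Properties.AbelianGroup G using (⁻¹-involutive; ⁻¹-injective)
  open import Relation.Binary.Reasoning.Setoid setoid

  bijectiveEnum-⁻¹ : ∀ {k} {f : Fin k → Carrier} → IsBijectiveEnum G f → IsBijectiveEnum G (λ a → f a ⁻¹)
  bijectiveEnum-⁻¹ {f = f} (f-injective , f-surjective) =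
    (λ a b eq → f-injective a b (⁻¹-injective eq)) ,
    (λ x → let (a , fa≈x⁻¹) = f-surjective (x ⁻¹)
           in a , trans (⁻¹-cong fa≈x⁻¹) (⁻¹-involutive x))

  kotzigArray-∷-inversePair : ∀ {j k} {f : Fin k → Carrier} {A : Fin j → Fin k → Carrier} →
    IsBijectiveEnum G f → IsKotzigArray G j k A →
    IsKotzigArray G (suc (suc j)) k (f ∷ (λ a → f a ⁻¹) ∷ A)
  kotzigArray-∷-inversePair {j} {f = f} {A} f-bijective (rows , columns) =
    (λ { zero → f-bijective ; (suc zero) → bijectiveEnum-⁻¹ f-bijective ; (suc (suc r)) → rows r }) ,
    λ a b → begin
      f a ∙ (f a ⁻¹ ∙ column a) ≈⟨ cancel (f a) (column a) ⟩
      column a                  ≈⟨ columns a b ⟩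
      column b                  ≈⟨ cancel (f b) (column b) ⟨
      f b ∙ (f b ⁻¹ ∙ column b) ∎
    where
    column : _ → Carrier
    column a = sumFin G j (λ r → A r a)
    cancel : ∀ x y → x ∙ (x ⁻¹ ∙ y) ≈ y
    cancel x y = trans (sym (assoc _ _ _)) (trans (∙-congʳ (inverseʳ x)) (identityˡ y))

  kotzigArray : ∀ {k} → HasOrder G k → ∀ j → 1 < j → 2 ∣ j ⊎ Σ _ (IsKotzigArray G 3 k) →
    Σ _ (IsKotzigArray G j k)
  kotzigArray _ 1 (s≤s ()) _
  kotzigArray (_ , e-bijective) 2 _ _ =
    _ , kotzigArray-∷-inversePair {A = λ ()} e-bijective ((λ ()) , λ _ _ → ≈-refl)
  kotzigArray _ 3 _ (inj₁ 2∣3) = ⊥-elim (from-no (2 ∣? 3) 2∣3)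
  kotzigArray _ 3 _ (inj₂ three) = three
  kotzigArray order@(_ , e-bijective) (suc (suc (suc (suc j)))) _ h =
    _ , kotzigArray-∷-inversePair e-bijective (proj₂ (kotzigArray order (suc (suc j)) (s≤s (s≤s z≤n)) h′))
    where
    h′ : 2 ∣ suc (suc j) ⊎ Σ _ (IsKotzigArray G 3 _)
    h′ = map₁ (λ 2∣4+j → ∣m+n∣m⇒∣n 2∣4+j ∣-refl) h

-- Abelian groups and their transfer to Fin k

module SubtractionLemmas {c ℓ} (G : AbelianGroup c ℓ) where

  open AbelianGroup G
  open import Algebra.Properties.AbelianGroup G
  open import Relation.Binary.Reasoning.Setoid setoid

  x-[x-y]≈y : ∀ x y → x - (x - y) ≈ y
  x-[x-y]≈y x y = begin
    x ∙ (x - y) ⁻¹   ≈⟨ ∙-congˡ (⁻¹-anti-homo‿- x y) ⟩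
    x ∙ (y ∙ x ⁻¹)   ≈⟨ assoc x y (x ⁻¹) ⟨
    x ∙ y ∙ x ⁻¹     ≈⟨ xyx⁻¹≈y x y ⟩
    y                ∎

  x∙y-y≈x : ∀ x y → x ∙ y - y ≈ x
  x∙y-y≈x x y = //-rightDividesʳ y x

  x-[y-z]-z≈x-y : ∀ x y z → x - (y - z) - z ≈ x - y
  x-[y-z]-z≈x-y x y z = begin
    x - (y - z) - z        ≈⟨ ∙-congʳ (∙-congˡ (⁻¹-anti-homo‿- y z)) ⟩
    x ∙ (z ∙ y ⁻¹) - z     ≈⟨ ∙-congʳ (∙-congˡ (comm z (y ⁻¹))) ⟩
    x ∙ (y ⁻¹ ∙ z) - z     ≈⟨ ∙-congʳ (assoc x (y ⁻¹) z) ⟨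
    (x - y) ∙ z - z        ≈⟨ x∙y-y≈x (x - y) z ⟩
    x - y                  ∎

  x-y≈z⇒y≈x-z : ∀ {x y z} → x - y ≈ z → y ≈ x - z
  x-y≈z⇒y≈x-z {x} {y} x-y≈z = trans (sym (x-[x-y]≈y x y)) (∙-congˡ (⁻¹-cong x-y≈z))

  x-y≈x-z⇒y≈z : ∀ {x y z} → x - y ≈ x - z → y ≈ z
  x-y≈x-z⇒y≈z {x} {y} {z} eq = ⁻¹-injective (∙-cancelˡ x (y ⁻¹) (z ⁻¹) eq)

-- The group structure of G moved to the index set Fin k of the enumeration e, where equality is
-- propositional and decidable and there is a linear order.
module Enumeration {c ℓ} (G : AbelianGroup c ℓ) {k : ℕ} (e : Fin k → AbelianGroup.Carrier G)
                   (e-bijective : IsBijectiveEnum G e) where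

  open AbelianGroup G hiding (isAbelianGroup)
  open import Relation.Binary.Reasoning.Setoid setoid

  index : Carrier → Fin k
  index x = proj₁ (proj₂ e-bijective x)

  e-index : ∀ x → e (index x) ≈ x
  e-index x = proj₂ (proj₂ e-bijective x)

  e-injective : ∀ {a b} → e a ≈ e b → a ≡ b
  e-injective = proj₁ e-bijective _ _

  index-cong : ∀ {x y} → x ≈ y → index x ≡ index y
  index-cong {x} {y} x≈y = e-injective (trans (e-index x) (trans x≈y (sym (e-index y))))

  index-injective : ∀ {x y} → index x ≡ index y → x ≈ y
  index-injective {x} {y} eq = trans (sym (e-index x)) (trans (reflexive (cong e eq)) (e-index y))

  infixl 7 _∙ᶠ_
  infix 8 _⁻¹ᶠ

  _∙ᶠ_ : Fin k → Fin k → Fin k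
  a ∙ᶠ b = index (e a ∙ e b)

  εᶠ : Fin k
  εᶠ = index ε

  _⁻¹ᶠ : Fin k → Fin k
  a ⁻¹ᶠ = index (e a ⁻¹)

  isAbelianGroup : IsAbelianGroup _≡_ _∙ᶠ_ εᶠ _⁻¹ᶠ
  isAbelianGroup = record
    { isGroup = record
      { isMonoid = record
        { isSemigroup = record
          { isMagma = record { isEquivalence = ≡.isEquivalence ; ∙-cong = cong₂ _∙ᶠ_ }
          ; assoc = λ a b c → e-injective (begin
              e ((a ∙ᶠ b) ∙ᶠ c)  ≈⟨ trans (e-index _) (∙-congʳ (e-index (e a ∙ e b))) ⟩
              e a ∙ e b ∙ e c    ≈⟨ assoc _ _ _ ⟩
              e a ∙ (e b ∙ e c)  ≈⟨ trans (e-index _) (∙-congˡ (e-index (e b ∙ e c))) ⟨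
              e (a ∙ᶠ (b ∙ᶠ c))  ∎) }
        ; identity = (λ a → e-injective (trans (e-index _) (trans (∙-congʳ (e-index ε)) (identityˡ _))))
                   , (λ a → e-injective (trans (e-index _) (trans (∙-congˡ (e-index ε)) (identityʳ _)))) }
      ; inverse = (λ a → index-cong (trans (∙-congʳ (e-index _)) (inverseˡ _)))
                , (λ a → index-cong (trans (∙-congˡ (e-index _)) (inverseʳ _)))
      ; ⁻¹-cong = cong _⁻¹ᶠ }
    ; comm = λ a b → index-cong (comm _ _) }

  finGroup : AbelianGroup 0ℓ 0ℓ
  finGroup = record { isAbelianGroup = isAbelianGroup }

  e-sumFin : ∀ j (f : Fin j → Fin k) → sumFin G j (e ∘ f) ≈ e (sumFin finGroup j f)
  e-sumFin zero    f = sym (e-index ε)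
  e-sumFin (suc j) f = trans (∙-congˡ (e-sumFin j (f ∘ suc))) (sym (e-index _))

  transport-kotzigArray : ∀ {j} → Σ _ (IsKotzigArray finGroup j k) → Σ _ (IsKotzigArray G j k)
  transport-kotzigArray {j} (A , rows , columns) =
    (λ r a → e (A r a)) , transport-row ∘ rows , λ a b → begin
      sumFin G j (λ r → e (A r a))         ≈⟨ e-sumFin j (λ r → A r a) ⟩
      e (sumFin finGroup j (λ r → A r a))  ≡⟨ cong e (columns a b) ⟩
      e (sumFin finGroup j (λ r → A r b))  ≈⟨ e-sumFin j (λ r → A r b) ⟨
      sumFin G j (λ r → e (A r b))         ∎
    where
    transport-row : ∀ {f} → IsBijectiveEnum finGroup f → IsBijectiveEnum G (e ∘ f)
    transport-row {f} (f-injective , f-surjective) =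
      (λ a b eq → f-injective a b (e-injective eq)) ,
      (λ x → let (a , fa≡) = f-surjective (index x) in a , trans (reflexive (cong e fa≡)) (e-index x))

  transport-involutions : MoreThanOneInvolution G → MoreThanOneInvolution finGroup
  transport-involutions (x , y , x-involution , y-involution , x≉y) =
    index x , index y , transport-involution x-involution , transport-involution y-involution ,
    x≉y ∘ index-injective
    where
    transport-involution : ∀ {x} → IsInvolution G x → IsInvolution finGroup (index x)
    transport-involution {x} (x≉ε , xx≈ε) =
      x≉ε ∘ index-injective ,
      index-cong (trans (∙-cong (e-index x) (e-index x)) xx≈ε)

module FinAbelianGroup {n : ℕ} {op : Op₂ (Fin (suc n))} {e : Fin (suc n)} {inv : Op₁ (Fin (suc n))}
                       (isAbelianGroup : IsAbelianGroup _≡_ op e inv) where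

  abelianGroup : AbelianGroup 0ℓ 0ℓ
  abelianGroup = record { isAbelianGroup = isAbelianGroup }

  open AbelianGroup abelianGroup hiding (refl; isAbelianGroup)
  open import Algebra.Properties.AbelianGroup abelianGroup
  open import Algebra.Properties.CommutativeSemigroup commutativeSemigroup using (interchange)
  open SubtractionLemmas abelianGroup
  open FinSums commutativeMonoid
    using (sum; sum-cong-≗; sum-replicate-zero; sum-involution; sum-fixedPointFree-involution;
           sum-indicator; sum-∘-injective; ∑-distrib-+; _·_; ×-distrib-+)
  open ≡.≡-Reasoning

  totalSum : Carrier
  totalSum = sum (λ x → x)

  selfInverseSum : Carrier
  selfInverseSum = sum (λ x → if does (x ≟ x ⁻¹) then x else ε)

  totalSum≡selfInverseSum : totalSum ≡ selfInverseSum
  totalSum≡selfInverseSum = begin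
    totalSum
      ≡⟨ sum-involution _⁻¹ ⁻¹-involutive (λ x → x) ⟩
    sum (λ x → if does (x <? x ⁻¹) then x ∙ x ⁻¹ else ε) ∙ selfInverseSum
      ≡⟨ cong (_∙ selfInverseSum) (trans (sum-cong-≗ cancelled) (sum-replicate-zero (suc n))) ⟩
    ε ∙ selfInverseSum
      ≡⟨ identityˡ _ ⟩
    selfInverseSum ∎
    where
    cancelled : ∀ x → (if does (x <? x ⁻¹) then x ∙ x ⁻¹ else ε) ≡ ε
    cancelled x with does (x <? x ⁻¹)
    ... | true  = inverseʳ x
    ... | false = refl

  selfInverse-∙ : ∀ {x y} → x ≡ x ⁻¹ → y ≡ y ⁻¹ → x ∙ y ≡ (x ∙ y) ⁻¹
  selfInverse-∙ {x} {y} x≡x⁻¹ y≡y⁻¹ = trans (cong₂ _∙_ x≡x⁻¹ y≡y⁻¹) (⁻¹-∙-comm x y)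

  selfInverse⇒square≡ε : ∀ {x} → x ≡ x ⁻¹ → x ∙ x ≡ ε
  selfInverse⇒square≡ε {x} x≡x⁻¹ = trans (cong (x ∙_) x≡x⁻¹) (inverseʳ x)

  module Translation {u} (u≢ε : u ≢ ε) (uu≡ε : u ∙ u ≡ ε) where

    translate-involutive : ∀ x → x ∙ u ∙ u ≡ x
    translate-involutive x = trans (assoc x u u) (trans (cong (x ∙_) uu≡ε) (identityʳ x))

    translate-fixedPointFree : ∀ x → x ∙ u ≢ x
    translate-fixedPointFree x eq = u≢ε (identityʳ-unique x u eq)

    selfInverse-translate : ∀ x → does (x ∙ u ≟ (x ∙ u) ⁻¹) ≡ does (x ≟ x ⁻¹)
    selfInverse-translate x = does-⇔ (mk⇔ backward forward) (x ∙ u ≟ (x ∙ u) ⁻¹) (x ≟ x ⁻¹)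
      where
      u≡u⁻¹ : u ≡ u ⁻¹
      u≡u⁻¹ = inverseʳ-unique u u uu≡ε
      forward : x ≡ x ⁻¹ → x ∙ u ≡ (x ∙ u) ⁻¹
      forward x≡x⁻¹ = selfInverse-∙ x≡x⁻¹ u≡u⁻¹
      backward : x ∙ u ≡ (x ∙ u) ⁻¹ → x ≡ x ⁻¹
      backward xu≡ = subst (λ y → y ≡ y ⁻¹) (translate-involutive x) (selfInverse-∙ xu≡ u≡u⁻¹)

    half : ℕ
    half = count (λ x → does (x <? x ∙ u) ∧ does (x ≟ x ⁻¹))

    selfInverseCount≡2*half : count (λ x → does (x ≟ x ⁻¹)) ≡ 2 * half
    selfInverseCount≡2*half =
      count-invariant (_∙ u) translate-involutive translate-fixedPointFree selfInverse-translate

    order-even : 2 ∣ suc n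
    order-even = subst (2 ∣_) order≡2*pairs (m∣m*n (count (λ x → does (x <? x ∙ u) ∧ true)))
      where
      order≡2*pairs : 2 * count (λ x → does (x <? x ∙ u) ∧ true) ≡ suc n
      order≡2*pairs = ≡.trans
        (≡.sym (count-invariant (_∙ u) translate-involutive translate-fixedPointFree
                                {b = λ _ → true} (λ _ → refl)))
        (count-true (suc n))

    selfInverseSum≡half·u : selfInverseSum ≡ half · u
    selfInverseSum≡half·u = begin
      selfInverseSum
        ≡⟨ sum-fixedPointFree-involution (_∙ u) translate-involutive translate-fixedPointFree f ⟩
      sum (λ x → if does (x <? x ∙ u) then f x ∙ f (x ∙ u) else ε)
        ≡⟨ sum-cong-≗ paired ⟩
      sum (λ x → if does (x <? x ∙ u) ∧ does (x ≟ x ⁻¹) then u else ε)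
        ≡⟨ sum-indicator (λ x → does (x <? x ∙ u) ∧ does (x ≟ x ⁻¹)) u ⟩
      half · u ∎
      where
      f : Carrier → Carrier
      f x = if does (x ≟ x ⁻¹) then x else ε
      paired : ∀ x → (if does (x <? x ∙ u) then f x ∙ f (x ∙ u) else ε)
                   ≡ (if does (x <? x ∙ u) ∧ does (x ≟ x ⁻¹) then u else ε)
      paired x rewrite selfInverse-translate x with does (x <? x ∙ u) | x ≟ x ⁻¹
      ... | true  | yes x≡x⁻¹ =
        trans (sym (assoc x x u)) (trans (cong (_∙ u) (selfInverse⇒square≡ε x≡x⁻¹)) (identityˡ u))
      ... | true  | no _      = identityˡ ε
      ... | false | _         = refl

  noInvolution⇒selfInverseSum≡ε : (∀ u → u ∙ u ≡ ε → u ≡ ε) → selfInverseSum ≡ ε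
  noInvolution⇒selfInverseSum≡ε no-involution = trans (sum-cong-≗ vanishes) (sum-replicate-zero (suc n))
    where
    vanishes : ∀ x → (if does (x ≟ x ⁻¹) then x else ε) ≡ ε
    vanishes x with x ≟ x ⁻¹
    ... | yes x≡x⁻¹ = no-involution x (selfInverse⇒square≡ε x≡x⁻¹)
    ... | no _      = refl

  oddOrder⇒noInvolution : ¬ 2 ∣ suc n → ∀ u → u ∙ u ≡ ε → u ≡ ε
  oddOrder⇒noInvolution odd u uu≡ε with u ≟ ε
  ... | yes u≡ε = u≡ε
  ... | no u≢ε  = ⊥-elim (odd (Translation.order-even u≢ε uu≡ε))

  twoInvolutions⇒selfInverseSum≡ε : MoreThanOneInvolution abelianGroup → selfInverseSum ≡ ε
  twoInvolutions⇒selfInverseSum≡ε (u , v , (u≢ε , uu≡ε) , (v≢ε , vv≡ε) , u≢v) =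
    identityʳ-unique selfInverseSum selfInverseSum (begin
      selfInverseSum ∙ selfInverseSum
        ≡⟨ cong₂ _∙_ U.selfInverseSum≡half·u V.selfInverseSum≡half·u ⟩
      U.half · u ∙ V.half · v
        ≡⟨ cong (λ h → U.half · u ∙ h · v) (half-unique V.half V.selfInverseCount≡2*half) ⟩
      U.half · u ∙ U.half · v
        ≡⟨ ×-distrib-+ u v U.half ⟨
      U.half · (u ∙ v)
        ≡⟨ cong (_· (u ∙ v)) (half-unique W.half W.selfInverseCount≡2*half) ⟨
      W.half · (u ∙ v)
        ≡⟨ W.selfInverseSum≡half·u ⟨
      selfInverseSum ∎)
    where
    uv≢ε : u ∙ v ≢ ε
    uv≢ε uv≡ε = u≢v (trans (inverseˡ-unique u v uv≡ε) (sym (inverseʳ-unique v v vv≡ε)))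
    uvuv≡ε : (u ∙ v) ∙ (u ∙ v) ≡ ε
    uvuv≡ε = trans (interchange u v u v) (trans (cong₂ _∙_ uu≡ε vv≡ε) (identityˡ ε))
    module U = Translation u≢ε uu≡ε
    module V = Translation v≢ε vv≡ε
    module W = Translation uv≢ε uvuv≡ε
    half-unique : ∀ h → count (λ x → does (x ≟ x ⁻¹)) ≡ 2 * h → h ≡ U.half
    half-unique h eq = ℕ.*-cancelˡ-≡ _ _ 2 (≡.trans (≡.sym eq) U.selfInverseCount≡2*half)

  totalSum≡ε : ¬ 2 ∣ suc n ⊎ MoreThanOneInvolution abelianGroup → totalSum ≡ ε
  totalSum≡ε (inj₁ odd) =
    trans totalSum≡selfInverseSum (noInvolution⇒selfInverseSum≡ε (oddOrder⇒noInvolution odd))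
  totalSum≡ε (inj₂ two) = trans totalSum≡selfInverseSum (twoInvolutions⇒selfInverseSum≡ε two)

  -- Given injective a and b = a − d on m indices, pick α ≠ α′ outside the image
  -- of a, put c₀ = α − d₀ and K = α′ ∙ c₀, and follow the chain c₀ = b i₀, K − a i₀ = b i₁, ... until it
  -- leaves the image of b. Rerouting a i to K − b i along the chain turns b i into the next chain value,
  -- which frees c₀ for the new index 0 with a′ 0 = α.
  module HallStep {m} (m+1<order : suc m < suc n) (d : Fin (suc m) → Carrier)
                  {a : Fin m → Carrier} (a-injective : Injective _≡_ _≡_ a)
                  (b-injective : Injective _≡_ _≡_ (λ i → a i - d (suc i))) where

    b : Fin m → Carrier
    b i = a i - d (suc i)

    α-missing : ∃ λ α → ∀ i → a i ≢ α
    α-missing = ∃-missing (ℕ.<-trans (ℕ.n<1+n m) m+1<order) a-injective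

    α : Carrier
    α = proj₁ α-missing

    α′-missing : ∃ λ α′ → ∀ i → (α ∷ a) i ≢ α′
    α′-missing = ∃-missing m+1<order (suc-injective⇒injective {f = α ∷ a} (proj₂ α-missing) a-injective)

    α′ : Carrier
    α′ = proj₁ α′-missing

    c₀ : Carrier
    c₀ = α - d zero

    K : Carrier
    K = α′ ∙ c₀

    Hit : Pred Carrier 0ℓ
    Hit c = ∃ λ i → b i ≡ c

    hit? : Decidable Hit
    hit? c = any? (λ i → b i ≟ c)

    next : ∀ c → Dec (Hit c) → Carrier
    next c (yes (i , _)) = K - a i
    next c (no _)        = c

    chain : ℕ → Carrier
    chain zero    = c₀
    chain (suc t) = next (chain t) (hit? (chain t))

    chain-suc : ∀ {i} t → b i ≡ chain t → chain (suc t) ≡ K - a i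
    chain-suc {i} t bi≡ with hit? (chain t)
    ... | yes (j , bj≡) = cong (λ l → K - a l) (b-injective (trans bj≡ (sym bi≡)))
    ... | no miss       = ⊥-elim (miss (i , bi≡))

    K-a≢c₀ : ∀ i → K - a i ≢ c₀
    K-a≢c₀ i eq = proj₂ α′-missing (suc i) (trans (x-y≈z⇒y≈x-z eq) (x∙y-y≈x α′ c₀))

    AllHit : ℕ → Set
    AllHit v = ∀ {t} → t < v → Hit (chain t)

    chain-injective : ∀ {v} → AllHit v → ∀ {t t′} → t < v → t′ < v → chain t ≡ chain t′ → t ≡ t′
    chain-injective hit {zero}  {zero}   _      _       _  = refl
    chain-injective hit {zero}  {suc t′} _      t′+1<v  eq with hit (ℕ.<⇒≤ t′+1<v)
    ... | _ , bj≡ = ⊥-elim (K-a≢c₀ _ (trans (sym (chain-suc t′ bj≡)) (sym eq)))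
    chain-injective hit {suc t} {zero}   t+1<v  _       eq with hit (ℕ.<⇒≤ t+1<v)
    ... | _ , bi≡ = ⊥-elim (K-a≢c₀ _ (trans (sym (chain-suc t bi≡)) eq))
    chain-injective hit {suc t} {suc t′} t+1<v  t′+1<v  eq with hit (ℕ.<⇒≤ t+1<v) | hit (ℕ.<⇒≤ t′+1<v)
    ... | i , bi≡ | i′ , bi′≡ = cong suc (chain-injective hit (ℕ.<⇒≤ t+1<v) (ℕ.<⇒≤ t′+1<v)
          (trans (sym bi≡) (trans (cong b i≡i′) bi′≡)))
      where
      i≡i′ : i ≡ i′
      i≡i′ = a-injective (x-y≈x-z⇒y≈z (trans (sym (chain-suc t bi≡)) (trans eq (chain-suc t′ bi′≡))))

    chain-escapes : ¬ AllHit (suc m)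
    chain-escapes hit = <⇒notInjective (ℕ.n<1+n m) index-injective
      where
      index : Fin (suc m) → Fin m
      index t = proj₁ (hit (toℕ<n t))
      index-injective : Injective _≡_ _≡_ index
      index-injective {t} {t′} eq = toℕ-injective (chain-injective hit (toℕ<n t) (toℕ<n t′)
        (trans (sym (proj₂ (hit (toℕ<n t)))) (trans (cong b eq) (proj₂ (hit (toℕ<n t′))))))

    first-escape : ∃ λ s → ¬ Hit (chain s) × AllHit s
    first-escape = least-counterexample (hit? ∘ chain) (suc m) chain-escapes

    s : ℕ
    s = proj₁ first-escape

    OnChain : Fin m → Set
    OnChain i = ∃ λ t → t < s × b i ≡ chain t

    onChain? : ∀ i → Dec (OnChain i)
    onChain? i = anyUpTo? (λ t → b i ≟ chain t) s

    onChain⇒K-b≡α′⊎a : ∀ {i} → OnChain i → K - b i ≡ α′ ⊎ ∃ λ j → OnChain j × K - b i ≡ a j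
    onChain⇒K-b≡α′⊎a (zero , _ , bi≡c₀) = inj₁ (trans (cong (K -_) bi≡c₀) (x∙y-y≈x α′ c₀))
    onChain⇒K-b≡α′⊎a (suc t , t<s , bi≡) with proj₂ (proj₂ first-escape) (ℕ.<⇒≤ t<s)
    ... | j , bj≡ = inj₂ (j , (t , ℕ.<⇒≤ t<s , bj≡) ,
                         trans (cong (K -_) (trans bi≡ (chain-suc t bj≡))) (x-[x-y]≈y K (a j)))

    onChain⇒K-b≢α : ∀ {i} → OnChain i → K - b i ≢ α
    onChain⇒K-b≢α p eq with onChain⇒K-b≡α′⊎a p
    ... | inj₁ K-bi≡α′       = proj₂ α′-missing zero (trans (sym eq) K-bi≡α′)
    ... | inj₂ (j , _ , e′)  = proj₂ α-missing j (trans (sym e′) eq)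

    K-b≡a⇒onChain : ∀ {i j} → OnChain i → K - b i ≡ a j → OnChain j
    K-b≡a⇒onChain {j = j} p eq with onChain⇒K-b≡α′⊎a p
    ... | inj₁ K-bi≡α′        = ⊥-elim (proj₂ α′-missing (suc j) (trans (sym eq) K-bi≡α′))
    ... | inj₂ (j′ , q , e′)  = subst OnChain (a-injective (trans (sym e′) eq)) q

    b≡K-a⇒onChain : ∀ {i j} → OnChain i → b j ≡ K - a i → OnChain j
    b≡K-a⇒onChain (t , t<s , bi≡) bj≡ with ℕ.m≤n⇒m<n∨m≡n t<s
    ... | inj₁ t+1<s = suc t , t+1<s , trans bj≡ (sym (chain-suc t bi≡))
    ... | inj₂ t+1≡s = ⊥-elim (proj₁ (proj₂ first-escape)
                                (subst (Hit ∘ chain) t+1≡s (_ , trans bj≡ (sym (chain-suc t bi≡)))))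

    b≡c₀⇒onChain : ∀ {j} → b j ≡ c₀ → OnChain j
    b≡c₀⇒onChain {j} bj≡c₀ = zero , ℕ.n≢0⇒n>0 s≢0 , bj≡c₀
      where
      s≢0 : s ≢ 0
      s≢0 s≡0 = proj₁ (proj₂ first-escape) (subst (Hit ∘ chain) (≡.sym s≡0) (j , bj≡c₀))

    reroute : ∀ i → Dec (OnChain i) → Carrier
    reroute i (yes _) = K - b i
    reroute i (no _)  = a i

    a′ : Fin (suc m) → Carrier
    a′ zero    = α
    a′ (suc i) = reroute i (onChain? i)

    K-b-d≡K-a : ∀ i → K - b i - d (suc i) ≡ K - a i
    K-b-d≡K-a i = x-[y-z]-z≈x-y K (a i) (d (suc i))

    a′-injective : Injective _≡_ _≡_ a′
    a′-injective = suc-injective⇒injective (λ i → fresh (onChain? i))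
                                           (λ {i} {j} → suc-injective (onChain? i) (onChain? j))
      where
      fresh : ∀ {i} (p? : Dec (OnChain i)) → reroute i p? ≢ α
      fresh     (yes p) = onChain⇒K-b≢α p
      fresh {i} (no _)  = proj₂ α-missing i
      suc-injective : ∀ {i j} (p? : Dec (OnChain i)) (q? : Dec (OnChain j)) →
                      reroute i p? ≡ reroute j q? → i ≡ j
      suc-injective (yes _) (yes _)  eq = b-injective (x-y≈x-z⇒y≈z eq)
      suc-injective (no _)  (no _)   eq = a-injective eq
      suc-injective (yes p) (no ¬q)  eq = ⊥-elim (¬q (K-b≡a⇒onChain p eq))
      suc-injective (no ¬p) (yes q)  eq = ⊥-elim (¬p (K-b≡a⇒onChain q (sym eq)))

    b′-injective : Injective _≡_ _≡_ (λ x → a′ x - d x)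
    b′-injective = suc-injective⇒injective (λ i → fresh (onChain? i))
                                           (λ {i} {j} → suc-injective (onChain? i) (onChain? j))
      where
      fresh : ∀ {i} (p? : Dec (OnChain i)) → reroute i p? - d (suc i) ≢ c₀
      fresh {i} (yes _) = K-a≢c₀ i ∘ trans (sym (K-b-d≡K-a i))
      fresh     (no ¬p) = ¬p ∘ b≡c₀⇒onChain
      suc-injective : ∀ {i j} (p? : Dec (OnChain i)) (q? : Dec (OnChain j)) →
                      reroute i p? - d (suc i) ≡ reroute j q? - d (suc j) → i ≡ j
      suc-injective {i} {j} (yes _) (yes _) eq =
        a-injective (x-y≈x-z⇒y≈z (trans (sym (K-b-d≡K-a i)) (trans eq (K-b-d≡K-a j))))
      suc-injective (no _) (no _) eq = b-injective eq
      suc-injective {i}     (yes p) (no ¬q) eq = ⊥-elim (¬q (b≡K-a⇒onChain p (trans (sym eq) (K-b-d≡K-a i))))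
      suc-injective {j = j} (no ¬p) (yes q) eq = ⊥-elim (¬p (b≡K-a⇒onChain q (trans eq (K-b-d≡K-a j))))

  hall-partial : ∀ {m} → m < suc n → (d : Fin m → Carrier) →
    ∃ λ (a : Fin m → Carrier) → Injective _≡_ _≡_ a × Injective _≡_ _≡_ (λ i → a i - d i)
  hall-partial {zero}  _ d = (λ ()) , (λ { {()} }) , (λ { {()} })
  hall-partial {suc m} m+1<order d with hall-partial (ℕ.<-trans (ℕ.n<1+n m) m+1<order) (d ∘ suc)
  ... | a , a-injective , b-injective = a′ , a′-injective , b′-injective
    where open HallStep m+1<order d a-injective b-injective

  -- M. Hall (1952).
  hall : (d : Fin (suc n) → Carrier) → sum d ≡ ε →
    ∃ λ (a : Fin (suc n) → Carrier) → ∃ λ (b : Fin (suc n) → Carrier) →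
      Injective _≡_ _≡_ a × Injective _≡_ _≡_ b × (∀ x → a x - b x ≡ d x)
  hall d Σd≡ε with hall-partial (ℕ.n<1+n n) (d ∘ suc)
  ... | a₀ , a₀-injective , b₀-injective = a , b , a-injective , b-injective , difference
    where
    α-missing : ∃ λ α → ∀ i → a₀ i ≢ α
    α-missing = ∃-missing (ℕ.n<1+n n) a₀-injective
    β-missing : ∃ λ β → ∀ i → a₀ i - d (suc i) ≢ β
    β-missing = ∃-missing (ℕ.n<1+n n) b₀-injective

    a b : Fin (suc n) → Carrier
    a = proj₁ α-missing ∷ a₀
    b = proj₁ β-missing ∷ (λ i → a₀ i - d (suc i))

    a-injective : Injective _≡_ _≡_ a
    a-injective = suc-injective⇒injective {f = a} (proj₂ α-missing) a₀-injective
    b-injective : Injective _≡_ _≡_ b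
    b-injective = suc-injective⇒injective {f = b} (proj₂ β-missing) b₀-injective

    difference-suc : ∀ i → a (suc i) - b (suc i) ≡ d (suc i)
    difference-suc i = x-[x-y]≈y (a₀ i) (d (suc i))

    -- a and b both enumerate Γ, so Σ (a − b) = ε = Σ d, which forces the difference at index 0.
    Σa≡Σb : sum a ≡ sum b
    Σa≡Σb = trans (sum-∘-injective a-injective (λ x → x)) (sym (sum-∘-injective b-injective (λ x → x)))

    Σ[a-b]≡ε : sum (λ x → a x - b x) ≡ ε
    Σ[a-b]≡ε = identityˡ-unique _ (sum b) (begin
      sum (λ x → a x - b x) ∙ sum b        ≡⟨ ∑-distrib-+ (λ x → a x - b x) b ⟨
      sum (λ x → (a x - b x) ∙ b x)        ≡⟨ sum-cong-≗ (λ x → //-rightDividesˡ (b x) (a x)) ⟩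
      sum a                                ≡⟨ Σa≡Σb ⟩
      sum b                                ∎)

    difference : ∀ x → a x - b x ≡ d x
    difference zero = ∙-cancelʳ (sum (d ∘ suc)) _ _ (begin
      (a zero - b zero) ∙ sum (d ∘ suc)
        ≡⟨ cong ((a zero - b zero) ∙_) (sum-cong-≗ difference-suc) ⟨
      (a zero - b zero) ∙ sum (λ i → a (suc i) - b (suc i))
        ≡⟨ Σ[a-b]≡ε ⟩
      ε
        ≡⟨ Σd≡ε ⟨
      d zero ∙ sum (d ∘ suc) ∎)
    difference (suc i) = difference-suc i

  injective⇒bijectiveEnum : ∀ {f : Fin (suc n) → Carrier} →
    Injective _≡_ _≡_ f → IsBijectiveEnum abelianGroup f
  injective⇒bijectiveEnum f-injective = (λ _ _ → f-injective) , injective⇒surjective f-injective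

  kotzigArray₃ : totalSum ≡ ε → Σ _ (IsKotzigArray abelianGroup 3 (suc n))
  kotzigArray₃ Σ≡ε with hall (λ x → x) Σ≡ε
  ... | a , b , a-injective , b-injective , a-b≡id =
    (a ∷ (λ x → b x ⁻¹) ∷ _⁻¹ ∷ []) ,
    (λ { zero → injective⇒bijectiveEnum a-injective
       ; (suc zero) → injective⇒bijectiveEnum (b-injective ∘ ⁻¹-injective)
       ; (suc (suc zero)) → injective⇒bijectiveEnum ⁻¹-injective }) ,
    λ x y → trans (column≡ε x) (sym (column≡ε y))
    where
    column≡ε : ∀ x → a x ∙ (b x ⁻¹ ∙ (x ⁻¹ ∙ ε)) ≡ ε
    column≡ε x = begin
      a x ∙ (b x ⁻¹ ∙ (x ⁻¹ ∙ ε))  ≡⟨ cong (λ y → a x ∙ (b x ⁻¹ ∙ y)) (identityʳ (x ⁻¹)) ⟩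
      a x ∙ (b x ⁻¹ ∙ x ⁻¹)        ≡⟨ assoc (a x) (b x ⁻¹) (x ⁻¹) ⟨
      (a x - b x) ∙ x ⁻¹           ≡⟨ cong (_∙ x ⁻¹) (a-b≡id x) ⟩
      x ∙ x ⁻¹                     ≡⟨ inverseʳ x ⟩
      ε                            ∎

mainTheorem14 : {c ℓ : Level} (G : AbelianGroup c ℓ) (k j : ℕ) →
    HasOrder G k → 1 < j →
    (2 ∣ j ⊎ ¬ (2 ∣ k) ⊎ MoreThanOneInvolution G) →
    Σ (Fin j → Fin k → AbelianGroup.Carrier G) (IsKotzigArray G j k)
mainTheorem14 G zero    j (_ , _ , e-surjective) _ _ =
  ⊥-elim (¬Fin0 (proj₁ (e-surjective (AbelianGroup.ε G))))
mainTheorem14 G (suc n) j order@(e , e-bijective) 1<j hypothesis =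
  kotzigArray G order j 1<j (map₂ threeRows hypothesis)
  where
  open Enumeration G e e-bijective
  open FinAbelianGroup isAbelianGroup using (totalSum≡ε; kotzigArray₃)
  threeRows : ¬ (2 ∣ suc n) ⊎ MoreThanOneInvolution G → Σ _ (IsKotzigArray G 3 (suc n))
  threeRows = transport-kotzigArray ∘ kotzigArray₃ ∘ totalSum≡ε ∘ map₂ transport-involutions
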